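{- Let $\mathcal U$ be a finite set and $R,R_0,\dots,R_{n-1}$ be $m$-place relations on $\mathcal U$ such that $R$ is a Boolean combination of $R_0,\dots,R_{n-1}$. Then $\lambda'_0(R)\le\sum_{\ell<n}\lambda'_0(R_\ell)$, and hence $\lambda_0(R)\le\sum_{\ell<n}\lambda_0(R_\ell)$.
   Context: For $A\subseteq\mathcal U$ and sequences $\bar b,\bar c$ of the same length, $\bar b\approx_A\bar c$ means: $b_i\in A\iff c_i\in A$; $b_i\in A\Rightarrow b_i=c_i$; $b_i=b_j\iff c_i=c_j$. For an $m$-place relation $S$ on $\mathcal U$, $\lambda'_0(S)=\min\{|A|:A\subseteq\mathcal U$ and $\bar b\approx_A\bar c\Rightarrow(S(\bar b)\iff S(\bar c))$ for all $\bar b,\bar c\in\mathcal U^m\}$ and $\lambda_0(S)=\min\{\lfloor|\mathcal U|/2\rfloor,\lambda'_0(S)\}$. -}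

module Defs where

open import Data.Nat using (ℕ; _≤_; _⊓_; _/_)
open import Data.Nat.ListAction using (sum)
open import Data.Fin using (Fin)
open import Data.Fin.Subset using (Subset; _∈_; ∣_∣)
open import Data.Bool using (Bool; true; not; _∧_)
open import Data.List using (tabulate)
open import Data.Product using (Σ; _×_)
open import Function.Bundles using (_⇔_)
open import Relation.Binary.PropositionalEquality using (_≡_)

-- The finite universe 𝓤 is Fin N (N = |𝓤|).
-- An m-place relation on 𝓤 is a (decidable) predicate on m-tuples,
-- represented as a Boolean-valued function on Fin m → Fin N.
Rel : ℕ → ℕ → Set
Rel N m = (Fin m → Fin N) → Bool

_≈[_]_ : ∀ {N m} → (Fin m → Fin N) → Subset N → (Fin m → Fin N) → Set
_≈[_]_ {N} {m} b A c =
  (∀ i → (b i ∈ A) ⇔ (c i ∈ A)) ×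
  (∀ i → b i ∈ A → b i ≡ c i) ×
  (∀ i j → (b i ≡ b j) ⇔ (c i ≡ c j))

Supports : ∀ {N m} → Subset N → Rel N m → Set
Supports {N} {m} A S = ∀ (b c : Fin m → Fin N) → b ≈[ A ] c → S b ≡ S c

IsLambda'₀ : ∀ {N m} → Rel N m → ℕ → Set
IsLambda'₀ {N} S k =
  Σ (Subset N) (λ A → Supports A S × ∣ A ∣ ≡ k) ×
  (∀ (A : Subset N) → Supports A S → k ≤ ∣ A ∣)

IsLambda₀ : ∀ {N m} → Rel N m → ℕ → Set
IsLambda₀ {N} S k = Σ ℕ (λ k' → IsLambda'₀ S k' × k ≡ (N / 2) ⊓ k')

data BoolFormula (n : ℕ) : Set where
  var  : Fin n → BoolFormula n
  tt   : BoolFormula n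
  neg  : BoolFormula n → BoolFormula n
  conj : BoolFormula n → BoolFormula n → BoolFormula n

eval : ∀ {n} → BoolFormula n → (Fin n → Bool) → Bool
eval (var l) v = v l
eval tt v = true
eval (neg φ) v = not (eval φ v)
eval (conj φ ψ) v = eval φ v ∧ eval ψ v

IsBooleanCombination : ∀ {N m n} → Rel N m → (Fin n → Rel N m) → Set
IsBooleanCombination {N} {m} {n} R Rs =
  Σ (BoolFormula n) (λ φ → ∀ (b : Fin m → Fin N) → R b ≡ eval φ (λ l → Rs l b))

Σ< : ∀ {n} → (Fin n → ℕ) → ℕ
Σ< k = sum (tabulate k)

module Submission where

open import Defs
open import Data.Nat using (ℕ; zero; suc; _≤_; _+_; _⊓_; _/_; z≤n; s≤s)
open import Data.Nat.Properties
open import Data.Nat.ListAction using (sum)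
open import Data.Fin using (Fin; zero; suc)
open import Data.Fin.Subset using (Subset; _∈_; ∣_∣; _∪_; _⊆_; ⋃; inside; outside)
open import Data.Fin.Subset.Properties using (∣⊥∣≡0; ∣p∣≤∣x∷p∣; p⊆p∪q; q⊆p∪q)
open import Data.Bool using (Bool; not; _∧_)
open import Data.Vec using (_∷_; [])
open import Data.List using (tabulate)
open import Data.List.Properties using (tabulate-cong)
open import Data.Product using (_×_; _,_; proj₁; proj₂)
open import Function using (_∘_)
open import Function.Bundles using (_⇔_; mk⇔; Equivalence)
open import Relation.Binary.PropositionalEquality

-- A union of supports of R₀,…,R_{n-1} supports every Boolean combination of them, and its size
-- is at most the sum of their sizes; λ₀ follows because x ↦ h ⊓ x is monotone and subadditive.

∣p∪q∣≤∣p∣+∣q∣ : ∀ {N} (p q : Subset N) → ∣ p ∪ q ∣ ≤ ∣ p ∣ + ∣ q ∣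
∣p∪q∣≤∣p∣+∣q∣ []            []            = z≤n
∣p∪q∣≤∣p∣+∣q∣ (inside  ∷ p) (x ∷ q)       =
  s≤s (≤-trans (∣p∪q∣≤∣p∣+∣q∣ p q) (+-monoʳ-≤ ∣ p ∣ (∣p∣≤∣x∷p∣ x q)))
∣p∪q∣≤∣p∣+∣q∣ (outside ∷ p) (inside  ∷ q) =
  ≤-trans (s≤s (∣p∪q∣≤∣p∣+∣q∣ p q)) (≤-reflexive (sym (+-suc ∣ p ∣ ∣ q ∣)))
∣p∪q∣≤∣p∣+∣q∣ (outside ∷ p) (outside ∷ q) = ∣p∪q∣≤∣p∣+∣q∣ p q

∣⋃∣≤Σ<∣∣ : ∀ {N n} (ps : Fin n → Subset N) → ∣ ⋃ (tabulate ps) ∣ ≤ Σ< (∣_∣ ∘ ps)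
∣⋃∣≤Σ<∣∣ {N} {zero}  ps = ≤-reflexive (∣⊥∣≡0 N)
∣⋃∣≤Σ<∣∣ {N} {suc n} ps =
  ≤-trans (∣p∪q∣≤∣p∣+∣q∣ (ps zero) _) (+-monoʳ-≤ ∣ ps zero ∣ (∣⋃∣≤Σ<∣∣ (ps ∘ suc)))

p⊆⋃ : ∀ {N n} (ps : Fin n → Subset N) l → ps l ⊆ ⋃ (tabulate ps)
p⊆⋃ ps zero    = p⊆p∪q _
p⊆⋃ ps (suc l) = q⊆p∪q (ps zero) _ ∘ p⊆⋃ (ps ∘ suc) l

Σ<-cong : ∀ {n} {f g : Fin n → ℕ} → (∀ l → f l ≡ g l) → Σ< f ≡ Σ< g
Σ<-cong f≗g = cong sum (tabulate-cong f≗g)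

⊓-subadditive : ∀ h a b → h ⊓ (a + b) ≤ h ⊓ a + h ⊓ b
⊓-subadditive h a b = begin
  h ⊓ (a + b)                   ≤⟨ ⊓-glb ≤h+hb ≤a+hb ⟩
  (h + h ⊓ b) ⊓ (a + h ⊓ b)     ≡⟨ +-distribʳ-⊓ (h ⊓ b) h a ⟨
  h ⊓ a + h ⊓ b                 ∎
  where
  open ≤-Reasoning
  ≤h+hb : h ⊓ (a + b) ≤ h + h ⊓ b
  ≤h+hb = ≤-trans (m⊓n≤m h (a + b)) (m≤m+n h (h ⊓ b))
  ≤a+hb : h ⊓ (a + b) ≤ a + h ⊓ b
  ≤a+hb = ≤-trans (⊓-monoˡ-≤ (a + b) (m≤n+m h a)) (≤-reflexive (sym (+-distribˡ-⊓ a h b)))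

⊓-Σ<-subadditive : ∀ {n} h (ks : Fin n → ℕ) → h ⊓ Σ< ks ≤ Σ< ((h ⊓_) ∘ ks)
⊓-Σ<-subadditive {zero}  h ks = ≤-reflexive (⊓-zeroʳ h)
⊓-Σ<-subadditive {suc n} h ks =
  ≤-trans (⊓-subadditive h (ks zero) _) (+-monoʳ-≤ (h ⊓ ks zero) (⊓-Σ<-subadditive h (ks ∘ suc)))

≈-antimono : ∀ {N m} {A B : Subset N} {b c : Fin m → Fin N} → A ⊆ B → b ≈[ B ] c → b ≈[ A ] c
≈-antimono {A = A} {b = b} {c} A⊆B (∈⇔∈ , ∈⇒≡ , ≡⇔≡) = ∈⇔∈′ , ∈⇒≡′ , ≡⇔≡
  where
  ∈⇒≡′ : ∀ i → b i ∈ A → b i ≡ c i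
  ∈⇒≡′ i = ∈⇒≡ i ∘ A⊆B
  ∈⇔∈′ : ∀ i → (b i ∈ A) ⇔ (c i ∈ A)
  ∈⇔∈′ i = mk⇔ (λ bi∈A → subst (_∈ A) (∈⇒≡′ i bi∈A) bi∈A)
                (λ ci∈A → subst (_∈ A) (sym (∈⇒≡ i (Equivalence.from (∈⇔∈ i) (A⊆B ci∈A)))) ci∈A)

Supports-mono : ∀ {N m} {A B : Subset N} {S : Rel N m} → A ⊆ B → Supports A S → Supports B S
Supports-mono A⊆B supp b c = supp b c ∘ ≈-antimono A⊆B

eval-cong : ∀ {n} (φ : BoolFormula n) {v w : Fin n → Bool} → (∀ l → v l ≡ w l) → eval φ v ≡ eval φ w
eval-cong (var l)    v≗w = v≗w l
eval-cong tt         v≗w = refl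
eval-cong (neg φ)    v≗w = cong not (eval-cong φ v≗w)
eval-cong (conj φ ψ) v≗w = cong₂ _∧_ (eval-cong φ v≗w) (eval-cong ψ v≗w)

⋃-Supports-BooleanCombination : ∀ {N m n} {R : Rel N m} {Rs : Fin n → Rel N m} {As : Fin n → Subset N} →
  IsBooleanCombination R Rs → (∀ l → Supports (As l) (Rs l)) → Supports (⋃ (tabulate As)) R
⋃-Supports-BooleanCombination {R = R} {Rs = Rs} {As} (φ , R≡φ) supp b c b≈c = begin
  R b                          ≡⟨ R≡φ b ⟩
  eval φ (λ l → Rs l b)        ≡⟨ eval-cong φ (λ l → Supports-mono (p⊆⋃ As l) (supp l) b c b≈c) ⟩
  eval φ (λ l → Rs l c)        ≡⟨ R≡φ c ⟨
  R c                          ∎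
  where open ≡-Reasoning

λ'₀-BooleanCombination-≤ : ∀ {N m n} {R : Rel N m} {Rs : Fin n → Rel N m} {k : ℕ} {ks : Fin n → ℕ} →
  IsBooleanCombination R Rs → IsLambda'₀ R k → (∀ l → IsLambda'₀ (Rs l) (ks l)) → k ≤ Σ< ks
λ'₀-BooleanCombination-≤ {N} {n = n} {Rs = Rs} {k} {ks} R≡φ (_ , minimal) λ'₀Rs = begin
  k                    ≤⟨ minimal (⋃ (tabulate As)) (⋃-Supports-BooleanCombination R≡φ (proj₁ ∘ support)) ⟩
  ∣ ⋃ (tabulate As) ∣  ≤⟨ ∣⋃∣≤Σ<∣∣ As ⟩
  Σ< (∣_∣ ∘ As)        ≡⟨ Σ<-cong (proj₂ ∘ support) ⟩
  Σ< ks                ∎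
  where
  open ≤-Reasoning
  As : Fin n → Subset N
  As = proj₁ ∘ proj₁ ∘ λ'₀Rs
  support : ∀ l → Supports (As l) (Rs l) × ∣ As l ∣ ≡ ks l
  support = proj₂ ∘ proj₁ ∘ λ'₀Rs

claim2p6 : ∀ (N m n : ℕ) (R : Rel N m) (Rs : Fin n → Rel N m) →
    IsBooleanCombination R Rs →
    (∀ (k : ℕ) (ks : Fin n → ℕ) → IsLambda'₀ R k → (∀ l → IsLambda'₀ (Rs l) (ks l)) → k ≤ Σ< ks) ×
    (∀ (k : ℕ) (ks : Fin n → ℕ) → IsLambda₀ R k → (∀ l → IsLambda₀ (Rs l) (ks l)) → k ≤ Σ< ks)
claim2p6 N m n R Rs R≡φ = λ'₀-bound , λ₀-bound
  where
  λ'₀-bound : ∀ k ks → IsLambda'₀ R k → (∀ l → IsLambda'₀ (Rs l) (ks l)) → k ≤ Σ< ks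
  λ'₀-bound _ _ = λ'₀-BooleanCombination-≤ R≡φ

  λ₀-bound : ∀ k ks → IsLambda₀ R k → (∀ l → IsLambda₀ (Rs l) (ks l)) → k ≤ Σ< ks
  λ₀-bound k ks (k′ , λ'₀R , refl) λ₀Rs = begin
    N / 2 ⊓ k′               ≤⟨ ⊓-monoʳ-≤ (N / 2) (λ'₀-bound k′ k′s λ'₀R (proj₁ ∘ proj₂ ∘ λ₀Rs)) ⟩
    N / 2 ⊓ Σ< k′s           ≤⟨ ⊓-Σ<-subadditive (N / 2) k′s ⟩
    Σ< ((N / 2 ⊓_) ∘ k′s)    ≡⟨ Σ<-cong (proj₂ ∘ proj₂ ∘ λ₀Rs) ⟨
    Σ< ks                    ∎
    where
    open ≤-Reasoning
    k′s : Fin n → ℕ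
    k′s = proj₁ ∘ λ₀Rs
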